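{- Let $p(x) \in \mathbf{Z}[x]$ have positive leading coefficient (so $p(n) > 0$ for $n \gg 0$). Then there is a unique representation of $p(n)$ in base $n$: \[ p(n) = c_d(n) n^d + \dots + c_1(n) n + c_0(n), \] where each $c_i(n)$ is a linear function of $n$ (a polynomial in $n$ of degree at most one) such that for all sufficiently large $n$ one has $0 \le c_i(n) \le n-1$ for $i = 0, 1, \dots, d$ and $0 < c_d(n) \le n-1$.
   Context: The integer $d$ in this representation is denoted $\deg_n(p(n))$; it need not equal $\deg p$ (e.g. $n^2 - n + 3 = (n-1)n + 3$ has $d = 1$). -}

module Defs where

open import Data.Nat using (ℕ; zero; suc)
open import Data.Fin using (Fin; zero; suc; toℕ; fromℕ)
open import Data.Integer using (ℤ; +_; _+_; _*_; _-_; _^_; _≤_; _<_)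
open import Data.List using (List; []; _∷_)
open import Data.Product using (_×_; _,_; Σ; ∃-syntax)
open import Relation.Binary.PropositionalEquality using (_≡_)

-- A polynomial in ℤ[x], given by its coefficient list, constant term first:
-- a₀ ∷ a₁ ∷ … ∷ aₘ ∷ []  represents  a₀ + a₁ x + … + aₘ xᵐ.
evalPoly : List ℤ → ℤ → ℤ
evalPoly []       x = + 0
evalPoly (a ∷ as) x = a + x * evalPoly as x

lin : ℤ × ℤ → ℤ → ℤ
lin (a , b) n = a * n + b

sumFin : (k : ℕ) → (Fin k → ℤ) → ℤ
sumFin zero    f = + 0
sumFin (suc k) f = f zero + sumFin k (λ i → f (suc i))

IsBaseRep : List ℤ → (d : ℕ) → (Fin (suc d) → ℤ × ℤ) → Set
IsBaseRep p d c =
  (∀ (n : ℤ) → evalPoly p n ≡ sumFin (suc d) (λ i → lin (c i) n * n ^ toℕ i))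
  × ∃[ N ] (∀ (n : ℤ) → N ≤ n →
       (∀ (i : Fin (suc d)) → (+ 0 ≤ lin (c i) n) × (lin (c i) n ≤ n - + 1))
       × (+ 0 < lin (c (fromℕ d)) n))

-- Say that c₀,…,c_d (pairs (a , b) standing for n ↦ a n + b) represent a
-- function V : ℤ → ℤ when V(n) = Σ cᵢ(n) nⁱ for every n and, for all large n,
-- every cᵢ(n) is a base-n digit and c_d(n) > 0.
--
-- Uniqueness holds for any V.  Evaluating at a large integer t, the values
-- cᵢ(t) form the base-t expansion of V(t); base-t expansions with a nonzero
-- leading digit are unique (division with remainder is unique, then induction
-- on the length).  So two representations have the same length and agree at
-- two consecutive points t and t + 1, and a linear function is determined by
-- two of its values.
--
-- Existence for p = a₀ + a₁x + … + lead·xᵐ with lead > 0 is subtraction with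
-- borrows: with an incoming borrow κ ∈ {0,1} put β = aᵢ - κ; the digit is the
-- constant β if β ≥ 0, and n + β (passing a borrow 1 upwards) if β < 0.  At
-- the top either lead - κ > 0 is a constant top digit, or lead = κ = 1 and the
-- digit n + β below it, eventually positive, becomes the top digit.
module Submission where

open import Defs
open import Data.Nat using (ℕ; suc)
open import Data.Fin using (Fin; toℕ)
open import Data.Integer using (ℤ; +_; _<_)
open import Data.List using (List; _∷ʳ_)
open import Data.Product using (_×_; Σ)
open import Relation.Binary.PropositionalEquality using (_≡_)

open import Data.Nat using (zero; z≤n; s≤s)
open import Data.Nat.Properties using (suc-injective)
open import Data.Fin using (zero; suc; fromℕ)
open import Data.Integer using (-[1+_]; _+_; _*_; _-_; -_; _^_; _≤_; _⊔_; +≤+; +<+; -≤-; -<+; _≟_)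
open import Data.Integer.Base using (nonNegative)
open import Data.Integer.Properties
  using ( ≤-refl; ≤-trans; <⇒≤; <-irrefl; <-cmp; i≤i⊔j; i≤j⊔i; i≤i+j; i≤j+i
        ; +-monoˡ-≤; +-monoʳ-≤; +-monoˡ-<; +-monoʳ-<; *-monoˡ-≤-nonNeg; *-monoʳ-≤-nonNeg
        ; i≤j⇒0≤j-i; 0≤i-j⇒j≤i; i<j⇒suc[i]≤j; suc[i]≤j⇒i<j
        ; +-comm; +-identityˡ; +-identityʳ; *-identityˡ; *-identityʳ; *-zeroʳ; +-0-abelianGroup
        ; module ≤-Reasoning)
open import Data.Integer.Tactic.RingSolver using (solve-∀)
open import Algebra.Properties.AbelianGroup +-0-abelianGroup using () renaming (∙-cancelʳ to +-cancelʳ)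
open import Data.List using ([]; _∷_)
open import Data.Product using (_,_; proj₁; ∃-syntax)
open import Data.Sum using (_⊎_; inj₁; inj₂)
open import Data.Vec.Functional using (head; tail) renaming (_∷_ to _◂_)
open import Data.Empty using (⊥-elim)
open import Relation.Nullary using (yes; no)
open import Relation.Binary.Definitions using (tri<; tri≈; tri>)
open import Relation.Binary.PropositionalEquality using (_≢_; refl; sym; trans; cong; cong₂; subst; module ≡-Reasoning)

Digit : ℤ → ℤ → Set
Digit n x = (+ 0 ≤ x) × (x ≤ n - + 1)

digit⇒base≥1 : ∀ {n x} → Digit n x → + 1 ≤ n
digit⇒base≥1 (0≤x , x≤n-1) = 0≤i-j⇒j≤i (≤-trans 0≤x x≤n-1)

≤-minus : ∀ {i j k} → i + j ≤ k → i ≤ k - j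
≤-minus {i} {j} {k} h = subst (_≤ k - j) (add-sub i j) (+-monoˡ-≤ (- j) h)
  where
  add-sub : ∀ i j → i + j - j ≡ i
  add-sub = solve-∀

digit-quotient-< : ∀ {n a b X Y} → Digit n a → + 0 ≤ b → X < Y → a + n * X < b + n * Y
digit-quotient-< {n} {a} {b} {X} {Y} da@(_ , a≤n-1) 0≤b X<Y = begin-strict
  a + n * X             ≤⟨ +-monoˡ-≤ (n * X) a≤n-1 ⟩
  (n - + 1) + n * X     <⟨ +-monoˡ-< (n * X) (+-monoʳ-< n -<+) ⟩
  (n + + 0) + n * X     ≡⟨ regroup n X ⟩
  n * (+ 1 + X)         ≤⟨ *-monoˡ-≤-nonNeg n {{nonNegative 0≤n}} (i<j⇒suc[i]≤j X<Y) ⟩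
  n * Y                 ≤⟨ i≤j+i (n * Y) b {{nonNegative 0≤b}} ⟩
  b + n * Y             ∎
  where
  open ≤-Reasoning
  0≤n : + 0 ≤ n
  0≤n = ≤-trans (+≤+ z≤n) (digit⇒base≥1 da)
  regroup : ∀ n X → (n + + 0) + n * X ≡ n * (+ 1 + X)
  regroup = solve-∀

quotient-unique : ∀ {n a b X Y} → Digit n a → Digit n b → a + n * X ≡ b + n * Y → X ≡ Y
quotient-unique {n} {X = X} {Y} da db eq with <-cmp X Y
... | tri< X<Y _ _ = ⊥-elim (<-irrefl eq (digit-quotient-< {n} da (proj₁ db) X<Y))
... | tri≈ _ X≡Y _ = X≡Y
... | tri> _ _ Y<X = ⊥-elim (<-irrefl (sym eq) (digit-quotient-< {n} db (proj₁ da) Y<X))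

SameSequence : {A : Set} (d : ℕ) → (Fin (suc d) → A) → (d' : ℕ) → (Fin (suc d') → A) → Set
SameSequence d x d' y = (d' ≡ d) × (∀ i j → toℕ i ≡ toℕ j → y j ≡ x i)

SameSequence-◂ : ∀ {A : Set} {d d'} {x : Fin (suc (suc d)) → A} {y : Fin (suc (suc d')) → A} →
  head y ≡ head x → SameSequence d (tail x) d' (tail y) → SameSequence (suc d) x (suc d') y
SameSequence-◂ {x = x} {y} y₀≡x₀ (refl , same-tail) = refl , same
  where
  same : ∀ i j → toℕ i ≡ toℕ j → y j ≡ x i
  same zero    zero    _    = y₀≡x₀
  same (suc i) (suc j) i≡j  = same-tail i j (suc-injective i≡j)

sumFin-scale : ∀ n k (x w : Fin k → ℤ) →
  sumFin k (λ i → x i * (n * w i)) ≡ n * sumFin k (λ i → x i * w i)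
sumFin-scale n zero    x w = sym (*-zeroʳ n)
sumFin-scale n (suc k) x w = begin
  x zero * (n * w zero) + sumFin k (λ i → x (suc i) * (n * w (suc i)))
    ≡⟨ cong (_+_ (x zero * (n * w zero))) (sumFin-scale n k (tail x) (tail w)) ⟩
  x zero * (n * w zero) + n * sumFin k (λ i → x (suc i) * w (suc i))
    ≡⟨ distrib (x zero) n (w zero) _ ⟩
  n * (x zero * w zero + sumFin k (λ i → x (suc i) * w (suc i)))  ∎
  where
  open ≡-Reasoning
  distrib : ∀ a n w s → a * (n * w) + n * s ≡ n * (a * w + s)
  distrib = solve-∀

horner : ℤ → (d : ℕ) → (Fin (suc d) → ℤ) → ℤ
horner n zero    x = head x
horner n (suc d) x = head x + n * horner n d (tail x)

sumFin≡horner : ∀ n d (x : Fin (suc d) → ℤ) → sumFin (suc d) (λ i → x i * n ^ toℕ i) ≡ horner n d x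
sumFin≡horner n zero    x = trans (+-identityʳ _) (*-identityʳ (head x))
sumFin≡horner n (suc d) x = cong₂ _+_ (*-identityʳ (head x)) (begin
  sumFin (suc d) (λ i → x (suc i) * (n * n ^ toℕ i)) ≡⟨ sumFin-scale n (suc d) (tail x) (λ i → n ^ toℕ i) ⟩
  n * sumFin (suc d) (λ i → x (suc i) * n ^ toℕ i)   ≡⟨ cong (n *_) (sumFin≡horner n d (tail x)) ⟩
  n * horner n d (tail x)                            ∎)
  where open ≡-Reasoning

DigitString : ℤ → (d : ℕ) → (Fin (suc d) → ℤ) → Set
DigitString n d x = (∀ i → Digit n (x i)) × (+ 0 < x (fromℕ d))

digitString-tail : ∀ {n d x} → DigitString n (suc d) x → DigitString n d (tail x)
digitString-tail (digits , top) = (λ i → digits (suc i)) , top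

horner-positive : ∀ n d x → DigitString n d x → + 0 < horner n d x
horner-positive n zero    x (_ , top) = top
horner-positive n (suc d) x ds@(digits , _) = begin-strict
  + 0                          <⟨ positive ⟩
  h                            ≡⟨ sym (*-identityˡ h) ⟩
  + 1 * h                      ≤⟨ *-monoʳ-≤-nonNeg h {{nonNegative (<⇒≤ positive)}} (digit⇒base≥1 {n} (digits zero)) ⟩
  n * h                        ≤⟨ i≤j+i (n * h) (head x) {{nonNegative (proj₁ (digits zero))}} ⟩
  head x + n * h               ∎
  where
  open ≤-Reasoning
  h = horner n d (tail x)
  positive : + 0 < h
  positive = horner-positive n d (tail x) (digitString-tail {n} ds)

digit≢longer : ∀ n {a d y} → Digit n a → DigitString n (suc d) y → a ≢ horner n (suc d) y
digit≢longer n {a} {d} {y} da dy eq =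
  <-irrefl zero≡higher (horner-positive n d (tail y) (digitString-tail {n} dy))
  where
  zero≡higher : + 0 ≡ horner n d (tail y)
  zero≡higher = quotient-unique {n} da (proj₁ dy zero) (trans (trans (cong (_+_ a) (*-zeroʳ n)) (+-identityʳ a)) eq)

horner-injective : ∀ n d d' x y → DigitString n d x → DigitString n d' y →
  horner n d x ≡ horner n d' y → SameSequence d x d' y
horner-injective n zero    zero     x y _        _        eq = refl , λ { zero zero _ → sym eq }
horner-injective n zero    (suc d') x y (dx , _) dy       eq = ⊥-elim (digit≢longer n (dx zero) dy eq)
horner-injective n (suc d) zero     x y dx       (dy , _) eq = ⊥-elim (digit≢longer n (dy zero) dx (sym eq))
horner-injective n (suc d) (suc d') x y dx dy eq =
  SameSequence-◂ (sym (+-cancelʳ (n * horner n d (tail x)) (head x) (head y) lowest-eq))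
                 (horner-injective n d d' (tail x) (tail y) (digitString-tail {n} dx) (digitString-tail {n} dy) higher)
  where
  higher : horner n d (tail x) ≡ horner n d' (tail y)
  higher = quotient-unique {n} (proj₁ dx zero) (proj₁ dy zero) eq
  lowest-eq : head x + n * horner n d (tail x) ≡ head y + n * horner n d (tail x)
  lowest-eq = trans eq (cong (λ h → head y + n * h) (sym higher))

lin-determined : ∀ u v t → lin u t ≡ lin v t → lin u (t + + 1) ≡ lin v (t + + 1) → u ≡ v
lin-determined (a , b) (a' , b') t at-t at-t+1 = cong₂ _,_ slope intercept
  where
  slope-formula : ∀ a b t → a ≡ (a * (t + + 1) + b) - (a * t + b)
  slope-formula = solve-∀
  intercept-formula : ∀ a b t → b ≡ (a * t + b) - a * t
  intercept-formula = solve-∀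
  slope : a ≡ a'
  slope = trans (slope-formula a b t) (trans (cong₂ _-_ at-t+1 at-t) (sym (slope-formula a' b' t)))
  intercept : b ≡ b'
  intercept = trans (intercept-formula a b t)
    (trans (cong₂ (λ v s → v - s * t) at-t slope) (sym (intercept-formula a' b' t)))

Eventually : (ℤ → Set) → Set
Eventually P = ∃[ N ] (∀ n → N ≤ n → P n)

eventually-mono : ∀ {P Q : ℤ → Set} → (∀ {n} → P n → Q n) → Eventually P → Eventually Q
eventually-mono f (N , p) = N , λ n N≤n → f (p n N≤n)

eventually-× : ∀ {P Q : ℤ → Set} → Eventually P → Eventually Q → Eventually (λ n → P n × Q n)
eventually-× (N , p) (M , q) =
  N ⊔ M , λ n h → p n (≤-trans (i≤i⊔j N M) h) , q n (≤-trans (i≤j⊔i N M) h)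

eventually-consecutive : ∀ {P : ℤ → Set} → Eventually P → ∃[ t ] (P t × P (t + + 1))
eventually-consecutive (N , p) = N , p N ≤-refl , p (N + + 1) (i≤i+j N (+ 1))

-- The linear digits c represent V.  This is IsBaseRep for an arbitrary
-- function in place of a polynomial, packaged as a record so that V, d and c
-- can be inferred from it.
record Represents (V : ℤ → ℤ) (d : ℕ) (c : Fin (suc d) → ℤ × ℤ) : Set where
  constructor represents
  field
    expansion : ∀ n → V n ≡ sumFin (suc d) (λ i → lin (c i) n * n ^ toℕ i)
    digits    : Eventually (λ n → DigitString n d (λ i → lin (c i) n))

fromIsBaseRep : ∀ p {d c} → IsBaseRep p d c → Represents (evalPoly p) d c
fromIsBaseRep p (expand , digits) = represents expand digits

toIsBaseRep : ∀ p {d c} → Represents (evalPoly p) d c → IsBaseRep p d c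
toIsBaseRep p (represents expand digits) = expand , digits

represents-unique : ∀ {V d d' c c'} → Represents V d c → Represents V d' c' → SameSequence d c d' c'
represents-unique {V} {d} {d'} {c} {c'} (represents expand digits) (represents expand' digits') =
  let t , (ds , ds') , (ds₁ , ds₁') = eventually-consecutive (eventually-× digits digits')
      (d'≡d , same-at-t) = values-at t ds ds'
      (_ , same-at-t+1)  = values-at (t + + 1) ds₁ ds₁'
  in d'≡d , λ i j i≡j → sym (lin-determined (c i) (c' j) t
                               (sym (same-at-t i j i≡j)) (sym (same-at-t+1 i j i≡j)))
  where
  open ≡-Reasoning
  values-at : ∀ n → DigitString n d (λ i → lin (c i) n) → DigitString n d' (λ j → lin (c' j) n) →
    SameSequence d (λ i → lin (c i) n) d' (λ j → lin (c' j) n)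
  values-at n ds ds' = horner-injective n d d' _ _ ds ds' (begin
    horner n d (λ i → lin (c i) n)                        ≡⟨ sym (sumFin≡horner n d _) ⟩
    sumFin (suc d) (λ i → lin (c i) n * n ^ toℕ i)        ≡⟨ sym (expand n) ⟩
    V n                                                   ≡⟨ expand' n ⟩
    sumFin (suc d') (λ j → lin (c' j) n * n ^ toℕ j)      ≡⟨ sumFin≡horner n d' _ ⟩
    horner n d' (λ j → lin (c' j) n)                      ∎)

represents-resp : ∀ {V W d c} → (∀ n → V n ≡ W n) → Represents V d c → Represents W d c
represents-resp V≡W (represents expand digits) = represents (λ n → trans (sym (V≡W n)) (expand n)) digits

represents-single : ∀ e → Eventually (λ n → Digit n (lin e n) × (+ 0 < lin e n)) →
  Represents (lin e) 0 (λ _ → e)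
represents-single e bounds = represents
  (λ n → sym (trans (+-identityʳ _) (*-identityʳ (lin e n))))
  (eventually-mono (λ (digit , positive) → (λ _ → digit) , positive) bounds)

represents-◂ : ∀ {V d c} e → Eventually (λ n → Digit n (lin e n)) → Represents V d c →
  Represents (λ n → lin e n + n * V n) (suc d) (e ◂ c)
represents-◂ {V} {d} {c} e low (represents expand digits) =
  represents expand-◂ (eventually-mono digits-◂ (eventually-× low digits))
  where
  open ≡-Reasoning
  expand-◂ : ∀ n → lin e n + n * V n
    ≡ lin e n * + 1 + sumFin (suc d) (λ i → lin (c i) n * (n * n ^ toℕ i))
  expand-◂ n = cong₂ _+_ (sym (*-identityʳ (lin e n))) (begin
    n * V n                                              ≡⟨ cong (n *_) (expand n) ⟩
    n * sumFin (suc d) (λ i → lin (c i) n * n ^ toℕ i)   ≡⟨ sym (sumFin-scale n (suc d) (λ i → lin (c i) n) (λ i → n ^ toℕ i)) ⟩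
    sumFin (suc d) (λ i → lin (c i) n * (n * n ^ toℕ i)) ∎)
  digits-◂ : ∀ {n} → Digit n (lin e n) × DigitString n d (λ i → lin (c i) n) →
    DigitString n (suc d) (λ i → lin ((e ◂ c) i) n)
  digits-◂ (digit , (higher , top)) = (λ { zero → digit ; (suc i) → higher i }) , top

borrow : ℤ → ℤ
borrow (+ _)    = + 0
borrow -[1+ _ ] = + 1

borrow-≤1 : ∀ β → borrow β ≤ + 1
borrow-≤1 (+ _)    = +≤+ z≤n
borrow-≤1 -[1+ _ ] = ≤-refl

borrow-nonNeg : ∀ {β} → + 0 ≤ β → borrow β ≡ + 0
borrow-nonNeg (+≤+ _) = refl

digitFor : ℤ → ℤ × ℤ
digitFor β = borrow β , β

digitFor-bounds : ∀ β → Eventually (λ n → Digit n (lin (digitFor β) n) × (β ≢ + 0 → + 0 < lin (digitFor β) n))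
digitFor-bounds (+ m) = + m + + 1 , λ n h → (+≤+ z≤n , ≤-minus h) , positive m
  where
  positive : ∀ m → + m ≢ + 0 → + 0 < + m
  positive zero    m≢0 = ⊥-elim (m≢0 refl)
  positive (suc _) _   = +<+ (s≤s z≤n)
digitFor-bounds -[1+ m ] = k + + 1 , λ n h →
  subst (λ x → Digit n x × (-[1+ m ] ≢ + 0 → + 0 < x)) (sym (lin-negative n))
        (digit n h , λ _ → positive n h)
  where
  -- β = -k with k ≥ 1, and the digit is n - k.
  k = + suc m
  lin-negative : ∀ n → lin (digitFor -[1+ m ]) n ≡ n - k
  lin-negative n = cong (_+ -[1+ m ]) (*-identityˡ n)
  digit : ∀ n → k + + 1 ≤ n → Digit n (n - k)
  digit n h = i≤j⇒0≤j-i (≤-trans (i≤i+j k (+ 1)) h) , +-monoʳ-≤ n (-≤- z≤n)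
  positive : ∀ n → k + + 1 ≤ n → + 0 < n - k
  positive n h = suc[i]≤j⇒i<j (≤-minus (subst (_≤ n) (+-comm k (+ 1)) h))

RepresentableAfterBorrow : List ℤ → ℤ → ℤ → Set
RepresentableAfterBorrow cs lead κ =
  ((cs ≡ []) × (lead ≡ κ))
  ⊎ Σ ℕ (λ d → Σ (Fin (suc d) → ℤ × ℤ) (λ c → Represents (λ n → evalPoly (cs ∷ʳ lead) n - κ) d c))

represents-digitFor : ∀ β → β ≢ + 0 → Represents (lin (digitFor β)) 0 (λ _ → digitFor β)
represents-digitFor β β≢0 =
  represents-single (digitFor β)
    (eventually-mono (λ (digit , positive) → digit , positive β≢0) (digitFor-bounds β))

representable-top : ∀ lead κ → κ ≤ lead → RepresentableAfterBorrow [] lead κ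
representable-top lead κ κ≤lead with lead ≟ κ
... | yes lead≡κ = inj₁ (refl , lead≡κ)
... | no  lead≢κ = inj₂ (0 , (λ _ → digitFor β) , represents-resp value (represents-digitFor β β≢0))
  where
  β = lead - κ
  add-back : ∀ l k → l ≡ l - k + k
  add-back = solve-∀
  β≢0 : β ≢ + 0
  β≢0 β≡0 = lead≢κ (trans (add-back lead κ) (trans (cong (_+ κ) β≡0) (+-identityˡ κ)))
  constant : ∀ l k n → l - k ≡ l + n * + 0 - k
  constant = solve-∀
  value : ∀ n → lin (digitFor β) n ≡ lead + n * + 0 - κ
  value n = trans (cong (λ b → b * n + β) (borrow-nonNeg (i≤j⇒0≤j-i κ≤lead)))
                  (trans (+-identityˡ β) (constant lead κ n))

-- One borrow step: the lowest digit of a + n·p(n) - κ is digitFor (a - κ), and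
-- what remains above it is p(n) minus the new borrow.
representable-step : ∀ a cs lead κ → + 0 < lead →
  RepresentableAfterBorrow cs lead (borrow (a - κ)) → RepresentableAfterBorrow (a ∷ cs) lead κ
representable-step a cs lead κ pos (inj₁ (refl , lead≡borrow)) =
  inj₂ (0 , (λ _ → digitFor β) , represents-resp value (represents-digitFor β β≢0))
  where
  β = a - κ
  -- Here p is the constant lead = borrow β > 0, so β < 0.
  β≢0 : β ≢ + 0
  β≢0 β≡0 = <-irrefl refl (subst (+ 0 <_) (trans lead≡borrow (cong borrow β≡0)) pos)
  regroup : ∀ b a k n → b * n + (a - k) ≡ a + n * (b + n * + 0) - k
  regroup = solve-∀
  value : ∀ n → lin (digitFor β) n ≡ a + n * (lead + n * + 0) - κ
  value n = trans (regroup (borrow β) a κ n) (cong (λ l → a + n * (l + n * + 0) - κ) (sym lead≡borrow))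
representable-step a cs lead κ _ (inj₂ (d , c , rep)) =
  inj₂ (suc d , digitFor β ◂ c , represents-resp value
         (represents-◂ (digitFor β) (eventually-mono proj₁ (digitFor-bounds β)) rep))
  where
  β = a - κ
  regroup : ∀ b a k n P → b * n + (a - k) + n * (P - b) ≡ a + n * P - k
  regroup = solve-∀
  value : ∀ n → lin (digitFor β) n + n * (evalPoly (cs ∷ʳ lead) n - borrow β)
                ≡ a + n * evalPoly (cs ∷ʳ lead) n - κ
  value n = regroup (borrow β) a κ n (evalPoly (cs ∷ʳ lead) n)

representable-after-borrow : ∀ cs lead κ → + 0 < lead → κ ≤ lead → RepresentableAfterBorrow cs lead κ
representable-after-borrow []       lead κ _   κ≤lead = representable-top lead κ κ≤lead
representable-after-borrow (a ∷ cs) lead κ pos _      =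
  representable-step a cs lead κ pos
    (representable-after-borrow cs lead (borrow (a - κ)) pos
       (≤-trans (borrow-≤1 (a - κ)) (i<j⇒suc[i]≤j pos)))

lemma3p1 : (cs : List ℤ) (lead : ℤ) → + 0 < lead →
    Σ ℕ (λ d → Σ (Fin (suc d) → ℤ × ℤ) (λ c →
      IsBaseRep (cs ∷ʳ lead) d c
      × (∀ (d' : ℕ) (c' : Fin (suc d') → ℤ × ℤ) → IsBaseRep (cs ∷ʳ lead) d' c' →
           (d' ≡ d) × (∀ (i : Fin (suc d)) (j : Fin (suc d')) → toℕ i ≡ toℕ j → c' j ≡ c i))))
lemma3p1 cs lead pos with representable-after-borrow cs lead (+ 0) pos (<⇒≤ pos)
... | inj₁ (_ , lead≡0) = ⊥-elim (<-irrefl (sym lead≡0) pos)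
... | inj₂ (d , c , rep) =
  d , c , toIsBaseRep (cs ∷ʳ lead) rep₀ ,
  λ d' c' rep' → represents-unique rep₀ (fromIsBaseRep (cs ∷ʳ lead) rep')
  where
  rep₀ : Represents (evalPoly (cs ∷ʳ lead)) d c
  rep₀ = represents-resp (λ n → +-identityʳ (evalPoly (cs ∷ʳ lead) n)) rep
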